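{- Let $M\ge1$ be an integer. For every $j=1,\ldots,M$ let $(R_j(n))_{n\ge1}$ be a reversible and positive inhomogeneous linear recurrence sequence (ILRS) of order $d_j\ge1$. Then for every integer $q\ge2$ there exists an integer $L$ with $1\le L\le q^{d_1\cdots d_M}$ such that the sequence $\bigl((R_1\circ\cdots\circ R_M)(n)\bmod q\bigr)_{n\ge1}$ is purely $L$-periodic, where $(S\circ T)(n)=S(T(n))$.
   Context: A sequence $(R(n))_{n\ge1}$ is an ILRS of order $d\ge1$ if it is a sequence of integers and there are integers $a_0,\ldots,a_{d-1},b$ with $a_0\ne0$ such that $R(n+d)=a_{d-1}R(n+d-1)+\cdots+a_0R(n)+b$ for every $n\ge1$; it is reversible if this holds with $a_0\in\{ -1,1\}$; positive means $R(n)>0$ for all $n$. $N\bmod q$ denotes the least non-negative residue of $N$ modulo $q$. A sequence $(t(n))_{n\ge n_0}$ is purely $L$-periodic if $t(n)=t(n+L)$ for all $n\ge n_0$. -}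

module Defs where

open import Data.Nat as ℕ using (ℕ; zero; suc; NonZero)
open import Data.Integer as ℤ using (ℤ; +_; ∣_∣; -1ℤ; 1ℤ; 0ℤ)
open import Data.Integer.DivMod using (_%ℕ_)
open import Data.Fin using (Fin; zero; suc; toℕ)
open import Data.Product using (Σ; ∃; _×_; _,_)
open import Data.Sum using (_⊎_)
open import Data.Empty using (⊥)
open import Relation.Binary.PropositionalEquality using (_≡_)

-- Sequences (R(n))_{n≥1} are modelled as functions ℕ → ℤ; the value at 0 is ignored.

linSum : (d : ℕ) → (Fin d → ℤ) → (ℕ → ℤ) → ℕ → ℤ
linSum zero    a R n = 0ℤ
linSum (suc d) a R n = a zero ℤ.* R n ℤ.+ linSum d (λ i → a (suc i)) R (suc n)

SatisfiesILR : (d : ℕ) → (Fin d → ℤ) → ℤ → (ℕ → ℤ) → Set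
SatisfiesILR d a b R = ∀ n → 1 ℕ.≤ n → R (n ℕ.+ d) ≡ linSum d a R n ℤ.+ b

ReversibleILRS : (d : ℕ) → (ℕ → ℤ) → Set
ReversibleILRS zero    R = ⊥
ReversibleILRS (suc d) R =
  Σ (Fin (suc d) → ℤ) λ a → Σ ℤ λ b →
    ((a zero ≡ 1ℤ) ⊎ (a zero ≡ -1ℤ)) × SatisfiesILR (suc d) a b R

Positive : (ℕ → ℤ) → Set
Positive R = ∀ n → 1 ℕ.≤ n → ℤ.+0 ℤ.< R n

-- (R_1 ∘ ⋯ ∘ R_M)(n); R_{j}(T(n)) evaluated at ∣T(n)∣, which equals T(n) for positive T.
composeAll : (M : ℕ) → (Fin M → ℕ → ℤ) → ℕ → ℤ
composeAll zero    R n = + n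
composeAll (suc M) R n = R zero ∣ composeAll M (λ j → R (suc j)) n ∣

prodFin : (M : ℕ) → (Fin M → ℕ) → ℕ
prodFin zero    d = 1
prodFin (suc M) d = d zero ℕ.* prodFin M (λ j → d (suc j))

PurelyPeriodic : ℕ → (ℕ → ℕ) → Set
PurelyPeriodic L t = ∀ n → 1 ℕ.≤ n → t n ≡ t (n ℕ.+ L)

-- The residues mod q of d consecutive terms of a reversible ILRS form a state in a set of
-- size q^d.  The recurrence determines the next state from the current one, and since
-- a₀ = ±1 is a unit mod q it also determines the previous one.  By pigeonhole two of the
-- first q^d + 1 states coincide, and running the dynamics back to the start shows that the
-- sequence mod q is purely periodic with a period L ≤ q^d.  For a composition S ∘ T with T
-- positive: if T mod L₀ has period L and S mod q has period L₀, then S ∘ T mod q has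
-- period L; induction on M gives L ≤ (q^d₁)^(d₂⋯d_M).

module Submission where

open import Defs
open import Data.Nat as ℕ using (ℕ; zero; suc; _≤_; _<_; _^_; NonZero; z≤n; s≤s; >-nonZero⁻¹)
open import Data.Fin as Fin using (Fin; toℕ; fromℕ<; combine)
open import Data.Fin.Properties using (pigeonhole; combine-injective; toℕ-fromℕ<; fromℕ<-cong; toℕ<n)
open import Data.Integer as ℤ using (ℤ; +_; -[1+_]; +[1+_]; 0ℤ; 1ℤ; -1ℤ; ∣_∣; +<+)
open import Data.Integer.DivMod using (_%ℕ_; _/ℕ_; a≡a%ℕn+[a/ℕn]*n; n%ℕd<d)
open import Data.List using (_∷_; [])
open import Data.Product using (Σ; ∃; _×_; _,_; proj₁; proj₂)
open import Data.Sum using (_⊎_; inj₁; inj₂)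
open import Data.Unit using (⊤; tt)
open import Data.Empty using (⊥-elim)
open import Function using (_∘_)
open import Relation.Binary.PropositionalEquality

infix 4 _≡_[mod_]

record _≡_[mod_] (x y m : ℤ) : Set where
  constructor _,_
  field
    quotient : ℤ
    equation : x ≡ y ℤ.+ quotient ℤ.* m

module _ {m : ℤ} where
  open import Data.Integer using (_+_; _*_; -_)
  open import Data.Integer.Properties using (*-assoc; *-identityˡ; +-0-abelianGroup)
  open import Data.Integer.Tactic.RingSolver using (solve)
  open import Algebra.Properties.AbelianGroup +-0-abelianGroup using (∙-cancelʳ)

  mod-refl : ∀ x → x ≡ x [mod m ]
  mod-refl x = 0ℤ , solve (x ∷ m ∷ [])

  mod-sym : ∀ {x y} → x ≡ y [mod m ] → y ≡ x [mod m ]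
  mod-sym {x} {y} (k , x≡) = - k , trans y≡ (cong (λ t → t + - k * m) (sym x≡))
    where
    y≡ : y ≡ (y + k * m) + - k * m
    y≡ = solve (y ∷ k ∷ m ∷ [])

  mod-trans : ∀ {x y z} → x ≡ y [mod m ] → y ≡ z [mod m ] → x ≡ z [mod m ]
  mod-trans {z = z} (k , refl) (l , refl) = l + k , solve (z ∷ k ∷ l ∷ m ∷ [])

  mod-+ : ∀ {x y u v} → x ≡ y [mod m ] → u ≡ v [mod m ] → x + u ≡ y + v [mod m ]
  mod-+ {y = y} {v = v} (k , refl) (l , refl) = k + l , solve (y ∷ v ∷ k ∷ l ∷ m ∷ [])

  mod-*ˡ : ∀ c {x y} → x ≡ y [mod m ] → c * x ≡ c * y [mod m ]
  mod-*ˡ c {y = y} (k , refl) = c * k , solve (c ∷ y ∷ k ∷ m ∷ [])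

  mod-+-cancelʳ : ∀ {x y u v} → x + u ≡ y + v [mod m ] → u ≡ v [mod m ] → x ≡ y [mod m ]
  mod-+-cancelʳ {x} {y} {u} h u≡v = cancel (mod-trans h (mod-+ (mod-refl y) (mod-sym u≡v)))
    where
    swap : ∀ k → y + u + k * m ≡ y + k * m + u
    swap k = solve (y ∷ u ∷ k ∷ m ∷ [])
    cancel : x + u ≡ y + u [mod m ] → x ≡ y [mod m ]
    cancel (k , eq) = k , ∙-cancelʳ u x (y + k * m) (trans eq (swap k))

  mod-unit-cancelˡ : ∀ c {x y} → c * c ≡ 1ℤ → c * x ≡ c * y [mod m ] → x ≡ y [mod m ]
  mod-unit-cancelˡ c c²≡1 h = subst₂ _≡_[mod m ] (c*c*≡id _) (c*c*≡id _) (mod-*ˡ c h)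
    where
    c*c*≡id : ∀ z → c * (c * z) ≡ z
    c*c*≡id z = trans (sym (*-assoc c c z)) (trans (cong (_* z) c²≡1) (*-identityˡ z))

module _ {q : ℕ} .{{_ : NonZero q}} where
  open _≡_[mod_] using (equation)
  open import Data.Nat.Properties using (≤-trans; ≤-reflexive; m≤n*m; m≤n+m; <⇒≱)
  open import Data.Integer using (_+_; _*_)
  open import Data.Integer.Properties using (+-identityʳ; +-injective; pos-+; pos-*)

  ≡-%ℕ : ∀ x → x ≡ + (x %ℕ q) [mod + q ]
  ≡-%ℕ x = x /ℕ q , a≡a%ℕn+[a/ℕn]*n x q

  %ℕ≡⇒≡[mod] : ∀ {x y} → x %ℕ q ≡ y %ℕ q → x ≡ y [mod + q ]
  %ℕ≡⇒≡[mod] {x} {y} e =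
    mod-trans (≡-%ℕ x) (subst (λ r → + r ≡ y [mod + q ]) (sym e) (mod-sym (≡-%ℕ y)))

  ≡+[1+k]*q⇒q≤ : ∀ {r s k} → + r ≡ + s + +[1+ k ] * + q → q ≤ r
  ≡+[1+k]*q⇒q≤ {r} {s} {k} e = ≤-trans (m≤n*m q (suc k)) (≤-trans (m≤n+m _ s) (≤-reflexive r≡))
    where
    r≡ : s ℕ.+ suc k ℕ.* q ≡ r
    r≡ = +-injective (sym (trans e (trans (cong (λ t → + s + t) (sym (pos-* (suc k) q))) (sym (pos-+ s _)))))

  <-≡[mod]⇒≡ : ∀ {r s} → r < q → s < q → + r ≡ + s [mod + q ] → r ≡ s
  <-≡[mod]⇒≡ {s = s} _ _ (+ zero , e) = +-injective (trans e (+-identityʳ (+ s)))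
  <-≡[mod]⇒≡ r<q _ (+[1+ k ] , e) = ⊥-elim (<⇒≱ r<q (≡+[1+k]*q⇒q≤ {k = k} e))
  <-≡[mod]⇒≡ _ s<q r≡s@(-[1+ k ] , _) = ⊥-elim (<⇒≱ s<q (≡+[1+k]*q⇒q≤ {k = k} (equation (mod-sym r≡s))))

  ≡[mod]⇒%ℕ≡ : ∀ {x y} → x ≡ y [mod + q ] → x %ℕ q ≡ y %ℕ q
  ≡[mod]⇒%ℕ≡ {x} {y} h = <-≡[mod]⇒≡ (n%ℕd<d x q) (n%ℕd<d y q)
    (mod-trans (mod-sym (≡-%ℕ x)) (mod-trans h (≡-%ℕ y)))

  residue : ℤ → Fin q
  residue x = fromℕ< (n%ℕd<d x q)

  residue-≡⇒≡[mod] : ∀ {x y} → residue x ≡ residue y → x ≡ y [mod + q ]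
  residue-≡⇒≡[mod] {x} {y} e = %ℕ≡⇒≡[mod]
    (trans (sym (toℕ-fromℕ< (n%ℕd<d x q))) (trans (cong toℕ e) (toℕ-fromℕ< (n%ℕd<d y q))))

  ≡[mod]⇒residue-≡ : ∀ {x y} → x ≡ y [mod + q ] → residue x ≡ residue y
  ≡[mod]⇒residue-≡ h = fromℕ<-cong _ _ (≡[mod]⇒%ℕ≡ h) _ _

module Windows (q : ℕ) (R : ℕ → ℤ) where
  open import Data.Nat using (_+_)
  open import Data.Nat.Properties using (+-identityʳ; +-suc)

  Agree : ℕ → ℕ → ℕ → Set
  Agree zero    m n = ⊤
  Agree (suc k) m n = R m ≡ R n [mod + q ] × Agree k (suc m) (suc n)

  reindex : ∀ {m m′ n n′} → m ≡ m′ → n ≡ n′ → R m ≡ R n [mod + q ] → R m′ ≡ R n′ [mod + q ]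
  reindex refl refl h = h

  Agree-snoc : ∀ k {m n} → Agree k m n → R (m + k) ≡ R (n + k) [mod + q ] → Agree (suc k) m n
  Agree-snoc zero    {m} {n} tt       last = reindex (+-identityʳ m) (+-identityʳ n) last , tt
  Agree-snoc (suc k) {m} {n} (h , hs) last = h , Agree-snoc k hs (reindex (+-suc m k) (+-suc n k) last)

  Agree-unsnoc : ∀ k {m n} → Agree (suc k) m n → Agree k m n × R (m + k) ≡ R (n + k) [mod + q ]
  Agree-unsnoc zero    {m} {n} (h , tt) = tt , reindex (sym (+-identityʳ m)) (sym (+-identityʳ n)) h
  Agree-unsnoc (suc k) {m} {n} (h , hs) with init , last ← Agree-unsnoc k hs =
    (h , init) , reindex (sym (+-suc m k)) (sym (+-suc n k)) last

  linSum-cong : ∀ k (c : Fin k → ℤ) {m n} → Agree k m n → linSum k c R m ≡ linSum k c R n [mod + q ]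
  linSum-cong zero    c tt       = mod-refl 0ℤ
  linSum-cong (suc k) c (h , hs) = mod-+ (mod-*ˡ (c Fin.zero) h) (linSum-cong k (λ i → c (Fin.suc i)) hs)

  module _ .{{_ : NonZero q}} where

    window : (k : ℕ) → ℕ → Fin (q ^ k)
    window zero    n = Fin.zero
    window (suc k) n = combine (residue (R n)) (window k (suc n))

    window-≡⇒Agree : ∀ k {m n} → window k m ≡ window k n → Agree k m n
    window-≡⇒Agree zero    _ = tt
    window-≡⇒Agree (suc k) {m} {n} e
      with head , tail ← combine-injective (residue (R m)) (window k (suc m)) (residue (R n)) (window k (suc n)) e
      = residue-≡⇒≡[mod] head , window-≡⇒Agree k tail

    Agree⇒window-≡ : ∀ k {m n} → Agree k m n → window k m ≡ window k n
    Agree⇒window-≡ zero    tt       = refl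
    Agree⇒window-≡ (suc k) (h , hs) = cong₂ combine (≡[mod]⇒residue-≡ h) (Agree⇒window-≡ k hs)

module ReversibleRecurrence (q : ℕ) {d : ℕ} {a : Fin (suc d) → ℤ} {b : ℤ} {R : ℕ → ℤ}
                            (a₀²≡1 : a Fin.zero ℤ.* a Fin.zero ≡ 1ℤ)
                            (rec : SatisfiesILR (suc d) a b R) where
  open import Data.Nat using (_+_)
  open import Data.Nat.Properties using (+-suc)
  open Windows q R

  Agree-step : ∀ {m n} → 1 ≤ m → 1 ≤ n → Agree (suc d) m n → Agree (suc d) (suc m) (suc n)
  Agree-step {m} {n} 1≤m 1≤n h = proj₂ (Agree-snoc (suc d) h next)
    where
    next : R (m + suc d) ≡ R (n + suc d) [mod + q ]
    next = subst₂ _≡_[mod + q ] (sym (rec m 1≤m)) (sym (rec n 1≤n))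
      (mod-+ (linSum-cong (suc d) a h) (mod-refl b))

  -- The recurrence at m expresses a₀ R(m) through the d later terms; a₀ is a unit.
  Agree-unstep : ∀ {m n} → 1 ≤ m → 1 ≤ n → Agree (suc d) (suc m) (suc n) → Agree (suc d) m n
  Agree-unstep {m} {n} 1≤m 1≤n h with init , last ← Agree-unsnoc d h = head , init
    where
    recurrence : linSum (suc d) a R m ℤ.+ b ≡ linSum (suc d) a R n ℤ.+ b [mod + q ]
    recurrence = subst₂ _≡_[mod + q ] (rec m 1≤m) (rec n 1≤n)
      (reindex (sym (+-suc m d)) (sym (+-suc n d)) last)
    head : R m ≡ R n [mod + q ]
    head = mod-unit-cancelˡ (a Fin.zero) a₀²≡1
      (mod-+-cancelʳ (mod-+-cancelʳ recurrence (mod-refl b)) (linSum-cong d (λ i → a (Fin.suc i)) init))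

module _ {N : ℕ} (s : ℕ → Fin N)
         (forward  : ∀ {m n} → s m ≡ s n → s (suc m) ≡ s (suc n))
         (backward : ∀ {m n} → s (suc m) ≡ s (suc n) → s m ≡ s n) where
  open import Data.Nat using (_+_; _∸_)
  open import Data.Nat.Properties using (+-identityʳ; n<1+n; m+[n∸m]≡n; m<n⇒0<n∸m; m∸n≤m; ≤-trans; ≤-pred; <⇒≤)

  forward* : ∀ t {m n} → s m ≡ s n → s (t + m) ≡ s (t + n)
  forward* zero    e = e
  forward* (suc t) e = forward (forward* t e)

  backward* : ∀ t {m n} → s (t + m) ≡ s (t + n) → s m ≡ s n
  backward* zero    e = e
  backward* (suc t) e = backward* t (backward e)

  -- Pigeonhole gives i < j ≤ N with s i ≡ s j; since the dynamics can be run backwards, s 0 ≡ s (j ∸ i).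
  reversible⇒periodic : ∃ λ L → 1 ≤ L × L ≤ N × ∀ n → s n ≡ s (n + L)
  reversible⇒periodic with i , j , i<j , sᵢ≡sⱼ ← pigeonhole (n<1+n N) (λ i → s (toℕ i)) =
    L , m<n⇒0<n∸m i<j , ≤-trans (m∸n≤m (toℕ j) (toℕ i)) (≤-pred (toℕ<n j)) , periodic
    where
    L = toℕ j ∸ toℕ i
    s₀≡s_L : s 0 ≡ s L
    s₀≡s_L = backward* (toℕ i)
      (subst₂ (λ u v → s u ≡ s v) (sym (+-identityʳ (toℕ i))) (sym (m+[n∸m]≡n (<⇒≤ i<j))) sᵢ≡sⱼ)
    periodic : ∀ n → s n ≡ s (n + L)
    periodic n = subst (λ u → s u ≡ s (n + L)) (+-identityʳ n) (forward* n s₀≡s_L)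

±1²≡1 : ∀ {c} → (c ≡ 1ℤ) ⊎ (c ≡ -1ℤ) → c ℤ.* c ≡ 1ℤ
±1²≡1 (inj₁ refl) = refl
±1²≡1 (inj₂ refl) = refl

reversibleILRS-periodic : ∀ d R → ReversibleILRS d R → (q : ℕ) .{{_ : NonZero q}}
  → ∃ λ L → 1 ≤ L × L ≤ q ^ d × PurelyPeriodic L (λ n → R n %ℕ q)
reversibleILRS-periodic zero    R () q
reversibleILRS-periodic (suc d) R (a , b , a₀≡±1 , rec) q =
  residues-periodic (reversible⇒periodic state forward backward)
  where
  open Windows q R
  open ReversibleRecurrence q {a = a} {R = R} (±1²≡1 a₀≡±1) rec
  state : ℕ → Fin (q ^ suc d)
  state n = window (suc d) (suc n)
  forward : ∀ {m n} → state m ≡ state n → state (suc m) ≡ state (suc n)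
  forward e = Agree⇒window-≡ (suc d) (Agree-step (s≤s z≤n) (s≤s z≤n) (window-≡⇒Agree (suc d) e))
  backward : ∀ {m n} → state (suc m) ≡ state (suc n) → state m ≡ state n
  backward e = Agree⇒window-≡ (suc d) (Agree-unstep (s≤s z≤n) (s≤s z≤n) (window-≡⇒Agree (suc d) e))
  residues-periodic : (∃ λ L → 1 ≤ L × L ≤ q ^ suc d × ∀ n → state n ≡ state (n ℕ.+ L))
    → ∃ λ L → 1 ≤ L × L ≤ q ^ suc d × PurelyPeriodic L (λ n → R n %ℕ q)
  residues-periodic (L , 1≤L , L≤ , periodic) =
    L , 1≤L , L≤ , λ { (suc n) _ → ≡[mod]⇒%ℕ≡ (proj₁ (window-≡⇒Agree (suc d) (periodic n))) }

module _ where
  open import Data.Nat using (_+_; _*_; _∸_; _%_; _/_)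
  open import Data.Nat.Properties
    using (+-identityʳ; *-identityʳ; +-assoc; *-distribʳ-+; m+[n∸m]≡n; m≤m+n; ≤-trans; ≤-total; ≤-reflexive; ^-monoˡ-≤; ^-*-assoc)
  open import Data.Nat.DivMod using (m≡m%n+[m/n]*n; [m+n]%n≡m%n)
  open import Data.Integer.Properties using (0≤i⇒+∣i∣≡i) renaming (<⇒≤ to <⇒≤ℤ)
  open ≡-Reasoning

  %≡∧/≤⇒≡+* : ∀ {L m n} .{{_ : NonZero L}} → m % L ≡ n % L → m / L ≤ n / L → n ≡ m + (n / L ∸ m / L) * L
  %≡∧/≤⇒≡+* {L} {m} {n} m%≡n% m/≤n/ = begin
    n                                                 ≡⟨ m≡m%n+[m/n]*n n L ⟩
    n % L + n / L * L                                 ≡⟨ cong₂ (λ r k → r + k * L) (sym m%≡n%) (sym (m+[n∸m]≡n m/≤n/)) ⟩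
    m % L + (m / L + (n / L ∸ m / L)) * L             ≡⟨ cong (_+_ (m % L)) (*-distribʳ-+ L (m / L) _) ⟩
    m % L + (m / L * L + (n / L ∸ m / L) * L)         ≡⟨ sym (+-assoc (m % L) _ _) ⟩
    m % L + m / L * L + (n / L ∸ m / L) * L           ≡⟨ cong (_+ (n / L ∸ m / L) * L) (sym (m≡m%n+[m/n]*n m L)) ⟩
    m + (n / L ∸ m / L) * L                           ∎

  module _ {L : ℕ} {t : ℕ → ℕ} (periodic : PurelyPeriodic L t) where

    periodic-+* : ∀ j {n} → 1 ≤ n → t n ≡ t (n + j * L)
    periodic-+* zero    {n} _   = cong t (sym (+-identityʳ n))
    periodic-+* (suc j) {n} 1≤n = begin
      t n                 ≡⟨ periodic n 1≤n ⟩
      t (n + L)           ≡⟨ periodic-+* j (≤-trans 1≤n (m≤m+n n L)) ⟩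
      t (n + L + j * L)   ≡⟨ cong t (+-assoc n L (j * L)) ⟩
      t (n + (L + j * L)) ∎

    periodic-%-cong : .{{_ : NonZero L}} → ∀ {m n} → 1 ≤ m → 1 ≤ n → m % L ≡ n % L → t m ≡ t n
    periodic-%-cong {m} {n} 1≤m 1≤n m%≡n% with ≤-total (m / L) (n / L)
    ... | inj₁ m/≤n/ = trans (periodic-+* (n / L ∸ m / L) 1≤m) (cong t (sym (%≡∧/≤⇒≡+* m%≡n% m/≤n/)))
    ... | inj₂ n/≤m/ = sym (trans (periodic-+* (m / L ∸ n / L) 1≤n) (cong t (sym (%≡∧/≤⇒≡+* (sym m%≡n%) n/≤m/))))

  positive⇒1≤∣∣ : ∀ {z} → + 0 ℤ.< z → 1 ≤ ∣ z ∣
  positive⇒1≤∣∣ (+<+ 0<k) = 0<k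

  positive-%ℕ : ∀ {L z} .{{_ : NonZero L}} → + 0 ℤ.< z → ∣ z ∣ % L ≡ z %ℕ L
  positive-%ℕ {L} 0<z = cong (_%ℕ L) (0≤i⇒+∣i∣≡i (<⇒≤ℤ 0<z))

  PurelyPeriodic-∘ : ∀ {q L₀ L} .{{_ : NonZero q}} .{{_ : NonZero L₀}} {S T : ℕ → ℤ} → Positive T
    → PurelyPeriodic L₀ (λ n → S n %ℕ q) → PurelyPeriodic L (λ n → T n %ℕ L₀)
    → PurelyPeriodic L (λ n → S ∣ T n ∣ %ℕ q)
  PurelyPeriodic-∘ {L = L} {T = T} T>0 S-periodic T-periodic n 1≤n =
    periodic-%-cong S-periodic (positive⇒1≤∣∣ Tₙ>0) (positive⇒1≤∣∣ Tₙ₊L>0)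
      (trans (positive-%ℕ Tₙ>0) (trans (T-periodic n 1≤n) (sym (positive-%ℕ Tₙ₊L>0))))
    where
    Tₙ>0 = T>0 n 1≤n
    Tₙ₊L>0 = T>0 (n + L) (≤-trans 1≤n (m≤m+n n L))

  composeAll-positive : ∀ M (R : Fin M → ℕ → ℤ) → (∀ j → Positive (R j)) → Positive (composeAll M R)
  composeAll-positive zero    R R>0 n 1≤n = +<+ 1≤n
  composeAll-positive (suc M) R R>0 n 1≤n =
    R>0 Fin.zero _ (positive⇒1≤∣∣ (composeAll-positive M (R ∘ Fin.suc) (R>0 ∘ Fin.suc) n 1≤n))

  ≤^-trans : ∀ q d P {L L₀} → L ≤ L₀ ^ P → L₀ ≤ q ^ d → L ≤ q ^ (d * P)
  ≤^-trans q d P L≤L₀^P L₀≤q^d =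
    ≤-trans L≤L₀^P (≤-trans (^-monoˡ-≤ P L₀≤q^d) (≤-reflexive (^-*-assoc q d P)))

  composeAll-periodic : (M : ℕ) (R : Fin M → ℕ → ℤ) (d : Fin M → ℕ)
    → (∀ j → ReversibleILRS (d j) (R j)) → (∀ j → Positive (R j))
    → (q : ℕ) → .{{_ : NonZero q}}
    → ∃ λ L → 1 ≤ L × L ≤ q ^ prodFin M d × PurelyPeriodic L (λ n → composeAll M R n %ℕ q)
  composeAll-periodic zero R d _ _ q =
    q , >-nonZero⁻¹ q , ≤-reflexive (sym (*-identityʳ q)) , λ n _ → sym ([m+n]%n≡m%n n q)
  composeAll-periodic (suc M) R d rev R>0 q
    with L₀@(suc _) , _ , L₀≤ , R₀-periodic ← reversibleILRS-periodic (d Fin.zero) (R Fin.zero) (rev Fin.zero) q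
    with L , 1≤L , L≤ , inner-periodic
           ← composeAll-periodic M (R ∘ Fin.suc) (d ∘ Fin.suc) (rev ∘ Fin.suc) (R>0 ∘ Fin.suc) L₀
    = L , 1≤L , ≤^-trans q (d Fin.zero) (prodFin M (d ∘ Fin.suc)) L≤ L₀≤ ,
      PurelyPeriodic-∘ {S = R Fin.zero} (composeAll-positive M (R ∘ Fin.suc) (R>0 ∘ Fin.suc))
        R₀-periodic inner-periodic

lemma2p2 : (M : ℕ) → 1 ≤ M → (R : Fin M → ℕ → ℤ) → (d : Fin M → ℕ)
    → (∀ j → 1 ≤ d j) → (∀ j → ReversibleILRS (d j) (R j)) → (∀ j → Positive (R j))
    → (q : ℕ) → .{{_ : NonZero q}} → 2 ≤ q
    → Σ ℕ (λ L → (1 ≤ L) × (L ≤ q ^ prodFin M d)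
    × PurelyPeriodic L (λ n → composeAll M R n %ℕ q))
lemma2p2 M _ R d _ rev R>0 q _ = composeAll-periodic M R d rev R>0 q
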